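{- Let $P$ be a poset and $n\in\omega$. Then $P\models\psi_n$ if and only if for all $p,q\in P$ with $p\not\leq q$, $\exists$ has an $n$-strategy for the game on $P$ with starting position $(\{p\},\{q\})$.
   Context: The game on $P$ with starting position $(U_0,V)$ ($U_0,V\subseteq P$) is played by $\forall$ and $\exists$ in rounds $0,1,2,\dots$; a set $U$ starts as $U_0$. $\forall$ wins in round $n$ if $U\cap V\neq\emptyset$ at the beginning of round $n$. In each round $\forall$ makes one of the moves: (1) pick $b\in P$ with $b\geq a$ for some $a\in U$; $\exists$ must add $b$ to $U$. (2) pick $a,b\in U$ such that $a\wedge b$ exists in $P$; $\exists$ must add $a\wedge b$ to $U$. (3) pick $a,b\in P$ such that $a\vee b$ exists in $P$ and lies in $U$; $\exists$ must choose one of $a,b$ and add it to $U$. $\exists$ has an $n$-strategy if she can guarantee that $\forall$ does not win in any round $\leq n$, however $\forall$ plays. Formulas (signature $\{\leq\}$): $J(x,y,z)$ holds exactly when $z$ is the join of $x,y$; $M(x,y,z)$ exactly when $z$ is the meet of $x,y$. For $\vec{x}_m=(x_1,\dots,x_m)$, $C_m(\vec{x}_m,y)$ is $\bigvee_{i=1}^m y=x_i$ ($C_0$ false) and $D_m=\neg C_m$. Recursively: $\phi_{m0}(\vec{x}_m,y)=D_m(\vec{x}_m,y)$ and $\phi_{m(n+1)}(\vec{x}_m,y)=\forall a\forall b\Big(\big(\exists c(C_m(\vec{x}_m,c)\wedge c\leq a)\rightarrow\phi_{(m+1)n}(\vec{x}_m,a,y)\big)\wedge\forall c\big((C_m(\vec{x}_m,a)\wedge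 C_m(\vec{x}_m,b)\wedge M(a,b,c))\rightarrow\phi_{(m+1)n}(\vec{x}_m,c,y)\big)\wedge\big(\exists c(C_m(\vec{x}_m,c)\wedge J(a,b,c))\rightarrow(\phi_{(m+1)n}(\vec{x}_m,a,y)\vee\phi_{(m+1)n}(\vec{x}_m,b,y))\big)\Big)$. $\psi_n=\forall x\forall y(\neg(x\leq y)\rightarrow\phi_{1n}(x,y))$. -}

module Defs where

open import Level using (Level; _⊔_)
open import Data.Nat using (ℕ; zero; suc)
open import Data.Vec using (Vec; []; _∷_; _∷ʳ_)
open import Data.Product using (Σ; ∃; _×_; _,_)
open import Data.Sum using (_⊎_)
open import Data.Empty using (⊥)
open import Relation.Nullary using (¬_)
open import Relation.Binary.PropositionalEquality using (_≡_)
open import Relation.Binary.Structures using (IsPartialOrder)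
open import Function.Bundles using (_⇔_)

module Poset {a ℓ : Level} (P : Set a) (_≤_ : P → P → Set ℓ) where

  J : P → P → P → Set (a ⊔ ℓ)
  J x y z = (x ≤ z × y ≤ z) × (∀ w → (x ≤ w × y ≤ w) → z ≤ w)

  M : P → P → P → Set (a ⊔ ℓ)
  M x y z = (z ≤ x × z ≤ y) × (∀ w → (w ≤ x × w ≤ y) → w ≤ z)

  C : ∀ {m} → Vec P m → P → Set a
  C [] y = Level.Lift a ⊥
  C (x ∷ xs) y = (y ≡ x) ⊎ C xs y

  D : ∀ {m} → Vec P m → P → Set a
  D xs y = ¬ C xs y

  -- φ n xs y  is  φ_{m n}(x⃗_m, y)  where m is the length of xs
  φ : (n : ℕ) → ∀ {m} → Vec P m → P → Set (a ⊔ ℓ)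
  φ zero xs y = Level.Lift (a ⊔ ℓ) (D xs y)
  φ (suc n) xs y =
    ∀ u v →
      ( (Σ P (λ c → C xs c × c ≤ u) → φ n (xs ∷ʳ u) y)
      × (∀ c → (C xs u × C xs v × M u v c) → φ n (xs ∷ʳ c) y)
      × (Σ P (λ c → C xs c × J u v c) → (φ n (xs ∷ʳ u) y ⊎ φ n (xs ∷ʳ v) y)) )

  ψ : ℕ → Set (a ⊔ ℓ)
  ψ n = ∀ x y → ¬ (x ≤ y) → φ n (x ∷ []) y

  Subset : Set (Level.suc a)
  Subset = P → Set a

  add : Subset → P → Subset
  add U b x = U x ⊎ x ≡ b

  ⟦_⟧ : P → Subset
  ⟦ p ⟧ x = x ≡ p

  Meets : Subset → Subset → Set a
  Meets U V = Σ P (λ x → U x × V x)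

  -- HasStrategy n U V : ∃ has an n-strategy from position (U, V), i.e. she
  -- can guarantee that ∀ does not win in any round ≤ n.
  HasStrategy : ℕ → Subset → Subset → Set (a ⊔ ℓ)
  HasStrategy zero U V = Level.Lift (a ⊔ ℓ) (¬ Meets U V)
  HasStrategy (suc n) U V =
    Level.Lift (a ⊔ ℓ) (¬ Meets U V)
    × (∀ u b → U u → u ≤ b → HasStrategy n (add U b) V)
    × (∀ u v c → U u → U v → M u v c → HasStrategy n (add U c) V)
    × (∀ u v c → U c → J u v c →
         HasStrategy n (add U u) V ⊎ HasStrategy n (add U v) V)

module Submission where

-- Read a tuple x⃗ = (x₁,…,xₘ) of parameters as the finite set
-- {x₁,…,xₘ}, i.e. as the current set U of the game.  The three conjuncts of
-- φ_{m(n+1)} are then literally the three moves of ∀ (adding the new element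
-- to U is appending it to x⃗), and a disjunction in φ is the choice of ∃.  The
-- only mismatch is the losing condition: HasStrategy demands U ∩ {y} = ∅ in
-- every round, whereas φ_{m(n+1)} only asks D_m at the very end.  For a
-- nonempty tuple this is harmless, because ∀ may replay x₁ ≥ x₁ (move 1) until
-- the last round, which forces D_m(x⃗, y) already now (reflexivity of ≤).

open import Defs
open import Level using (Level; lift; lower)
open import Data.Nat using (ℕ; zero; suc)
open import Data.Vec using (Vec; []; _∷_; _∷ʳ_)
open import Data.Product using (Σ; _×_; _,_; proj₁; proj₂)
open import Data.Sum using (_⊎_; inj₁; inj₂; [_,_]′; map)
open import Relation.Nullary using (¬_)
open import Relation.Binary.PropositionalEquality using (_≡_; refl)
open import Relation.Binary.Structures using (IsPartialOrder)
open import Function.Base using (id)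
open import Function.Bundles using (_⇔_; mk⇔; Equivalence)

open Equivalence using (to; from)

module GameFormulas {a ℓ : Level} (P : Set a) (_≤_ : P → P → Set ℓ) where
  open Poset P _≤_

  C-snoc-elim : ∀ {m} (xs : Vec P m) b x → C (xs ∷ʳ b) x → C xs x ⊎ x ≡ b
  C-snoc-elim []       b x (inj₁ x≡b)      = inj₂ x≡b
  C-snoc-elim []       b x (inj₂ (lift ()))
  C-snoc-elim (y ∷ xs) b x (inj₁ x≡y)      = inj₁ (inj₁ x≡y)
  C-snoc-elim (y ∷ xs) b x (inj₂ x∈xs∷ʳb)  = map inj₂ id (C-snoc-elim xs b x x∈xs∷ʳb)

  C-snoc-intro : ∀ {m} (xs : Vec P m) b x → C xs x ⊎ x ≡ b → C (xs ∷ʳ b) x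
  C-snoc-intro []       b x (inj₁ (lift ()))
  C-snoc-intro []       b x (inj₂ x≡b)        = inj₁ x≡b
  C-snoc-intro (y ∷ xs) b x (inj₁ (inj₁ x≡y)) = inj₁ x≡y
  C-snoc-intro (y ∷ xs) b x (inj₁ (inj₂ x∈xs)) = inj₂ (C-snoc-intro xs b x (inj₁ x∈xs))
  C-snoc-intro (y ∷ xs) b x (inj₂ x≡b)        = inj₂ (C-snoc-intro xs b x (inj₂ x≡b))

  Represents : Subset → ∀ {m} → Vec P m → Set a
  Represents U xs = ∀ x → U x ⇔ C xs x

  represents-add : ∀ {m} {U : Subset} {xs : Vec P m} b →
                   Represents U xs → Represents (add U b) (xs ∷ʳ b)
  represents-add {U = U} {xs} b U≅xs x = mk⇔
    [ (λ Ux → C-snoc-intro xs b x (inj₁ (to (U≅xs x) Ux)))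
    , (λ x≡b → C-snoc-intro xs b x (inj₂ x≡b)) ]′
    (λ x∈xs∷ʳb → map (from (U≅xs x)) id (C-snoc-elim xs b x x∈xs∷ʳb))

  represents-singleton : ∀ p → Represents ⟦ p ⟧ (p ∷ [])
  represents-singleton p x = mk⇔ inj₁ [ (λ x≡p → x≡p) , (λ ()) ]′

  represents-avoids : ∀ {m} {U : Subset} {xs : Vec P m} {y} →
                      Represents U xs → D xs y → ¬ Meets U ⟦ y ⟧
  represents-avoids U≅xs y∉xs (x , Ux , refl) = y∉xs (to (U≅xs x) Ux)

  strategy⇒φ : ∀ n {m} {U : Subset} {xs : Vec P m} y →
               Represents U xs → HasStrategy n U ⟦ y ⟧ → φ n xs y
  strategy⇒φ zero y U≅xs (lift U∩y=∅) = lift (λ y∈xs → U∩y=∅ (y , from (U≅xs y) y∈xs , refl))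
  strategy⇒φ (suc n) {U = U} {xs} y U≅xs (_ , up , meet , join) u v =
    upMove , meetMove , joinMove
    where
    next : ∀ b → HasStrategy n (add U b) ⟦ y ⟧ → φ n (xs ∷ʳ b) y
    next b = strategy⇒φ n y (represents-add b U≅xs)

    upMove : Σ P (λ c → C xs c × c ≤ u) → φ n (xs ∷ʳ u) y
    upMove (c , c∈xs , c≤u) = next u (up c u (from (U≅xs c) c∈xs) c≤u)

    meetMove : ∀ c → C xs u × C xs v × M u v c → φ n (xs ∷ʳ c) y
    meetMove c (u∈xs , v∈xs , c=u∧v) =
      next c (meet u v c (from (U≅xs u) u∈xs) (from (U≅xs v) v∈xs) c=u∧v)

    joinMove : Σ P (λ c → C xs c × J u v c) → φ n (xs ∷ʳ u) y ⊎ φ n (xs ∷ʳ v) y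
    joinMove (c , c∈xs , c=u∨v) = map (next u) (next v) (join u v c (from (U≅xs c) c∈xs) c=u∨v)

  module _ (≤-refl : ∀ {x} → x ≤ x) where

    -- For a nonempty tuple φ_{mn}(x⃗, y) already forces y ∉ x⃗: ∀ keeps
    -- playing x₁ ≥ x₁, which leads to D in the last round.
    φ⇒D : ∀ n {m} (xs : Vec P (suc m)) y → φ n xs y → D xs y
    φ⇒D zero    xs       y φxs          = lower φxs
    φ⇒D (suc n) (x ∷ xs) y φxs y∈x∷xs =
      φ⇒D n ((x ∷ xs) ∷ʳ x) y (proj₁ (φxs x x) (x , inj₁ refl , ≤-refl))
        (C-snoc-intro (x ∷ xs) x y (inj₁ y∈x∷xs))

    -- Formula ⇒ strategy: ∃ answers every move as the matching conjunct of φ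
    -- prescribes; φ⇒D guarantees that ∀ has not won yet.
    φ⇒strategy : ∀ n {m} {U : Subset} {xs : Vec P (suc m)} y →
                 Represents U xs → φ n xs y → HasStrategy n U ⟦ y ⟧
    φ⇒strategy zero y U≅xs φxs = lift (represents-avoids U≅xs (lower φxs))
    φ⇒strategy (suc n) {U = U} {xs} y U≅xs φxs =
      lift (represents-avoids U≅xs (φ⇒D (suc n) xs y φxs)) , upMove , meetMove , joinMove
      where
      next : ∀ b → φ n (xs ∷ʳ b) y → HasStrategy n (add U b) ⟦ y ⟧
      next b = φ⇒strategy n y (represents-add b U≅xs)

      upMove : ∀ u b → U u → u ≤ b → HasStrategy n (add U b) ⟦ y ⟧
      upMove u b Uu u≤b = next b (proj₁ (φxs b b) (u , to (U≅xs u) Uu , u≤b))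

      meetMove : ∀ u v c → U u → U v → M u v c → HasStrategy n (add U c) ⟦ y ⟧
      meetMove u v c Uu Uv c=u∧v =
        next c (proj₁ (proj₂ (φxs u v)) c (to (U≅xs u) Uu , to (U≅xs v) Uv , c=u∧v))

      joinMove : ∀ u v c → U c → J u v c →
                 HasStrategy n (add U u) ⟦ y ⟧ ⊎ HasStrategy n (add U v) ⟦ y ⟧
      joinMove u v c Uc c=u∨v =
        map (next u) (next v) (proj₂ (proj₂ (φxs u v)) (c , to (U≅xs c) Uc , c=u∨v))

proposition4p2 : ∀ {a ℓ : Level} (P : Set a) (_≤_ : P → P → Set ℓ)
    → IsPartialOrder _≡_ _≤_ → (n : ℕ)
    → Poset.ψ P _≤_ n
      ⇔ (∀ p q → ¬ (p ≤ q) → Poset.HasStrategy P _≤_ n (Poset.⟦_⟧ P _≤_ p) (Poset.⟦_⟧ P _≤_ q))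
proposition4p2 P _≤_ isPartialOrder n = mk⇔
  (λ ψn p q p≰q → φ⇒strategy (IsPartialOrder.refl isPartialOrder) n q
                     (represents-singleton p) (ψn p q p≰q))
  (λ strategies p q p≰q → strategy⇒φ n q (represents-singleton p) (strategies p q p≰q))
  where open GameFormulas P _≤_
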